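{- Let $G$ be a minimal counterexample (as defined in the context) and let $H$ be obtained from $G$ by deleting all vertices of degree $1$. Then every vertex $v$ of $G$ has a neighbor $u$ in $G$ with $d_G(u)\ge 3$; and consequently every vertex of $H$ has a neighbor in $H$ whose degree in $H$ is at least $3$.
   Context: All graphs are finite and simple. $\mathrm{mad}(G)=\max\{2|E(F)|/|V(F)|:F\subseteq G\}$. Two edges are at distance two if they share no endpoint and an endpoint of one is adjacent to an endpoint of the other. An injective $k$-edge-coloring of $G$ is a map $\phi:E(G)\to\{1,\dots,k\}$ with $\phi(e)\neq\phi(e')$ whenever $e,e'$ are at distance two or lie in a common triangle; $\chi_i'(G)$ is the least such $k$. A minimal counterexample is a connected graph $G$ with $\Delta(G)\le 4$, $\mathrm{mad}(G)<\frac83$ and $\chi_i'(G)>7$, such that every graph $G'$ with $\Delta(G')\le4$, $\mathrm{mad}(G')<\frac83$ and $|V(G')|+|E(G')|<|V(G)|+|E(G)|$ satisfies $\chi_i'(G')\le 7$. $d_G,d_H$ denote degrees in $G$, $H$. -}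

module Defs where

open import Data.Nat using (ℕ; zero; suc; _+_; _*_; _≤_; _<_; _≡ᵇ_; _<ᵇ_)
open import Data.Fin using (Fin; toℕ)
import Data.Fin as F
open import Data.Bool using (Bool; true; false; T; if_then_else_; _∧_; not)
open import Data.Product using (Σ; _×_; ∃-syntax)
open import Relation.Binary.PropositionalEquality using (_≡_; _≢_)
open import Relation.Nullary using (¬_)
open import Function using (_∘_)

record Graph : Set where
  field
    n      : ℕ
    adj    : Fin n → Fin n → Bool
    symm   : ∀ u v → adj u v ≡ adj v u
    irrefl : ∀ v → adj v v ≡ false
open Graph public

count : ∀ {m} → (Fin m → Bool) → ℕ
count {zero}  f = 0
count {suc m} f = (if f F.zero then 1 else 0) + count (f ∘ F.suc)

sumF : ∀ {m} → (Fin m → ℕ) → ℕ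
sumF {zero}  f = 0
sumF {suc m} f = f F.zero + sumF (f ∘ F.suc)

countPairs : ∀ {m} → (Fin m → Fin m → Bool) → ℕ
countPairs r = sumF (λ u → count (λ w → (toℕ u <ᵇ toℕ w) ∧ r u w))

deg : (G : Graph) → Fin (n G) → ℕ
deg G v = count (adj G v)

edgeCount : Graph → ℕ
edgeCount G = countPairs (adj G)

MaxDegAtMost : ℕ → Graph → Set
MaxDegAtMost k G = ∀ v → deg G v ≤ k

record Subgraph (G : Graph) : Set where
  field
    vs     : Fin (n G) → Bool
    es     : Fin (n G) → Fin (n G) → Bool
    es-sym : ∀ u v → es u v ≡ es v u
    es-adj : ∀ u v → T (es u v) → T (adj G u v)
    es-vs  : ∀ u v → T (es u v) → T (vs u) × T (vs v)
open Subgraph public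

|V| : ∀ {G} → Subgraph G → ℕ
|V| F = count (vs F)

|E| : ∀ {G} → Subgraph G → ℕ
|E| F = countPairs (es F)

-- mad(G) < p / q, i.e. for every (nonempty) subgraph F,
-- 2|E(F)|/|V(F)| < p/q, written without division as q·2|E(F)| < p·|V(F)|.
MadLessThan : ℕ → ℕ → Graph → Set
MadLessThan p q G = (F : Subgraph G) → 0 < |V| F → q * (2 * |E| F) < p * |V| F

data Reach (G : Graph) : Fin (n G) → Fin (n G) → Set where
  here : ∀ {v} → Reach G v v
  step : ∀ {u w v} → T (adj G u w) → Reach G w v → Reach G u v

Connected : Graph → Set
Connected G = ∀ u v → Reach G u v

record InjectiveEdgeColoring (k : ℕ) (G : Graph) : Set where
  field
    φ        : Fin (n G) → Fin (n G) → Fin k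
    φ-sym    : ∀ u v → T (adj G u v) → φ u v ≡ φ v u
    -- edges uv and xy at distance two (no common endpoint, v adjacent to x;
    -- all orientations are covered since u,v,x,y range over ordered pairs)
    dist-two : ∀ u v x y → T (adj G u v) → T (adj G x y) →
               u ≢ x → u ≢ y → v ≢ x → v ≢ y → T (adj G v x) →
               φ u v ≢ φ x y
    triangle : ∀ a b c → T (adj G a b) → T (adj G a c) → T (adj G b c) →
               φ a b ≢ φ a c
open InjectiveEdgeColoring public

InjChromaticAtMost : ℕ → Graph → Set
InjChromaticAtMost k G = InjectiveEdgeColoring k G

MinimalCounterexample : Graph → Set
MinimalCounterexample G =
  Connected G × MaxDegAtMost 4 G × MadLessThan 8 3 G ×
  ¬ InjChromaticAtMost 7 G ×
  ((G' : Graph) → MaxDegAtMost 4 G' → MadLessThan 8 3 G' →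
     n G' + edgeCount G' < n G + edgeCount G → InjChromaticAtMost 7 G')

-- H = G minus all vertices of degree 1, represented as the induced subgraph
-- of G on the vertices of degree ≠ 1.
inH : (G : Graph) → Fin (n G) → Bool
inH G v = not (deg G v ≡ᵇ 1)

degH : (G : Graph) → Fin (n G) → ℕ
degH G v = count (λ w → adj G v w ∧ inH G w)

-- A minimal counterexample G has no injective 7-edge-colouring, whereas isolating a non-isolated
-- vertex c (deleting its edges) leaves a smaller graph, which has one. Its colouring extends to G
-- once every edge cx can get a colour missing from the edges near cx; there are at most
-- Σ (d(a) − 1) of these, over the other neighbours a of c and of x. Two new edges in a triangle cxy
-- are separated by colouring in two passes: the later of them avoids the first-pass colour of the
-- earlier, which keeps that colour because it lies in no other triangle. The count is at most 6
-- when all neighbours of c have degree at most 2, so every vertex has a neighbour of degree at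
-- least 3 (by connectivity no vertex is isolated), and when c is a leaf whose neighbour u has degree
-- at most 3 or a second leaf neighbour. So a vertex of degree at least 3 with a leaf neighbour has
-- degree 4 and only one leaf neighbour, and keeps degree at least 3 in H.
module Submission where

open import Defs
open import Data.Bool using (Bool; true; false; T; not; _∧_; if_then_else_)
open import Data.Bool.Properties using (∧-comm; ∧-identityʳ)
open import Data.Empty using (⊥-elim)
open import Data.Fin using (Fin; zero; suc; toℕ)
open import Data.Fin.Properties using (_≟_; any?; pigeonhole)
import Data.Fin.Properties as Fin
import Data.Nat.Properties as Nat
open import Data.List using (List; []; _∷_; _++_; [_]; length; lookup)
open import Data.List.Properties using (length-++)
open import Data.List.Membership.Propositional using (_∈_; _∉_)
open import Data.List.Membership.Propositional.Properties using (∈-++⁺ˡ; ∈-++⁺ʳ)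
open import Data.List.Relation.Unary.Any using (here; index)
import Data.List.Relation.Unary.Any as Any
open import Data.List.Relation.Unary.Any.Properties using (lookup-index)
open import Data.Nat using (ℕ; zero; suc; _+_; _*_; _≤_; _<_; z≤n; s≤s; _≤?_; _<ᵇ_; _≡ᵇ_)
open import Data.Nat.Properties
  using ( ≤-refl; ≤-reflexive; ≤-trans; ≤-pred; n<1+n; <-asym; <⇒≢; ≤⇒≯; ≰⇒>; ≮⇒≥
        ; <⇒<ᵇ; <ᵇ⇒<; ≡ᵇ⇒≡; +-mono-≤; +-mono-<-≤; +-mono-≤-<; +-monoʳ-<
        ; *-zeroʳ; *-suc; *-identityˡ; *-monoʳ-≤; module ≤-Reasoning )
open import Data.Product using (_×_; _,_; proj₁; proj₂; ∃-syntax)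
open import Data.Sum using (_⊎_; inj₁; inj₂)
open import Data.Unit using (tt)
open import Function using (_∘_)
open import Relation.Binary.Definitions using (tri<; tri≈; tri>)
open import Relation.Binary.PropositionalEquality using (_≡_; _≢_; refl; sym; trans; cong; cong₂; subst; module ≡-Reasoning)
open import Relation.Nullary using (¬_; yes; no; does; ¬?; T?; _×-dec_; decidable-stable; toSum)

∧-intro : ∀ {x y} → T x → T y → T (x ∧ y)
∧-intro {true} _ q = q

∧-elimˡ : ∀ {x y} → T (x ∧ y) → T x
∧-elimˡ {true} _ = tt

∧-elimʳ : ∀ {x y} → T (x ∧ y) → T y
∧-elimʳ {true} q = q

_≢ᵇ_ : ∀ {m} → Fin m → Fin m → Bool
a ≢ᵇ b = not (does (a ≟ b))

≢ᵇ⇒≢ : ∀ {m} {a b : Fin m} → T (a ≢ᵇ b) → a ≢ b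
≢ᵇ⇒≢ {a = a} {b} h with a ≟ b
... | no a≢b = a≢b

≢⇒≢ᵇ : ∀ {m} {a b : Fin m} → a ≢ b → T (a ≢ᵇ b)
≢⇒≢ᵇ {a = a} {b} a≢b with a ≟ b
... | yes a≡b = a≢b a≡b
... | no _ = tt

if-true : ∀ {A : Set} {b} {x y : A} → T b → (if b then x else y) ≡ x
if-true {b = true} _ = refl

if-false : ∀ {A : Set} {b} {x y : A} → ¬ T b → (if b then x else y) ≡ y
if-false {b = false} _ = refl
if-false {b = true} ¬b = ⊥-elim (¬b tt)

≤-if : ∀ {b k x} → T b → x ≤ k → x ≤ (if b then k else 0)
≤-if {true} _ x≤k = x≤k

indicator-mono : ∀ {x y} → (T x → T y) → (if x then 1 else 0) ≤ (if y then 1 else 0)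
indicator-mono {false} _ = z≤n
indicator-mono {true} {true} _ = ≤-refl
indicator-mono {true} {false} x⇒y = ⊥-elim (x⇒y tt)

indicator-< : ∀ {x y} → ¬ T x → T y → (if x then 1 else 0) < (if y then 1 else 0)
indicator-< {false} {true} _ _ = s≤s z≤n
indicator-< {true} ¬x _ = ⊥-elim (¬x tt)

count-cong : ∀ {m} {f g : Fin m → Bool} → (∀ a → f a ≡ g a) → count f ≡ count g
count-cong {zero} f≗g = refl
count-cong {suc m} {f} f≗g = cong₂ _+_ (cong (λ b → if b then 1 else 0) (f≗g zero)) (count-cong (f≗g ∘ suc))

count-mono : ∀ {m} {f g : Fin m → Bool} → (∀ a → T (f a) → T (g a)) → count f ≤ count g
count-mono {zero} f⇒g = z≤n
count-mono {suc m} f⇒g = +-mono-≤ (indicator-mono (f⇒g zero)) (count-mono (f⇒g ∘ suc))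

count-< : ∀ {m} {f g : Fin m → Bool} → (∀ a → T (f a) → T (g a)) →
  ∀ a → ¬ T (f a) → T (g a) → count f < count g
count-< f⇒g zero ¬fa ga = +-mono-<-≤ (indicator-< ¬fa ga) (count-mono (f⇒g ∘ suc))
count-< f⇒g (suc a) ¬fa ga = +-mono-≤-< (indicator-mono (f⇒g zero)) (count-< (f⇒g ∘ suc) a ¬fa ga)

count-remove : ∀ {m} (f : Fin m → Bool) {a} → T (f a) → count f ≡ suc (count (λ b → f b ∧ b ≢ᵇ a))
count-remove f {zero} fa with f zero | fa
... | true | _ = cong suc (count-cong (λ b → sym (∧-identityʳ (f (suc b)))))
count-remove f {suc a} fa with f zero
... | true = cong suc (count-remove (f ∘ suc) fa)
... | false = count-remove (f ∘ suc) fa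

count-pos : ∀ {m} (f : Fin m → Bool) {a} → T (f a) → 0 < count f
count-pos f fa = subst (0 <_) (sym (count-remove f fa)) (s≤s z≤n)

count≤1-unique : ∀ {m} (f : Fin m → Bool) {a b} → count f ≤ 1 → T (f a) → T (f b) → b ≡ a
count≤1-unique f {a} {b} atMostOne fa fb with b ≟ a
... | yes b≡a = b≡a
... | no b≢a = ⊥-elim (≤⇒≯ atMostOne (subst (1 <_) (sym (count-remove f fa))
                 (s≤s (count-pos (λ c → f c ∧ c ≢ᵇ a) (∧-intro fb (≢⇒≢ᵇ b≢a))))))

count-remove-≤ : ∀ {m} (f : Fin m → Bool) {a k} → count f ≤ suc k → T (f a) →
  count (λ b → f b ∧ b ≢ᵇ a) ≤ k
count-remove-≤ f f≤1+k fa = ≤-pred (subst (_≤ _) (count-remove f fa) f≤1+k)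

sumF-mono : ∀ {m} {f g : Fin m → ℕ} → (∀ a → f a ≤ g a) → sumF f ≤ sumF g
sumF-mono {zero} f≤g = z≤n
sumF-mono {suc m} f≤g = +-mono-≤ (f≤g zero) (sumF-mono (f≤g ∘ suc))

sumF-< : ∀ {m} {f g : Fin m → ℕ} → (∀ a → f a ≤ g a) → ∀ a → f a < g a → sumF f < sumF g
sumF-< f≤g zero lt = +-mono-<-≤ lt (sumF-mono (f≤g ∘ suc))
sumF-< f≤g (suc a) lt = +-mono-≤-< (f≤g zero) (sumF-< (f≤g ∘ suc) a lt)

sumF-indicator : ∀ {m} (p : Fin m → Bool) k → sumF (λ a → if p a then k else 0) ≡ k * count p
sumF-indicator {zero} p k = sym (*-zeroʳ k)
sumF-indicator {suc m} p k with p zero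
... | true = trans (cong (k +_) (sumF-indicator (p ∘ suc) k)) (sym (*-suc k _))
... | false = sumF-indicator (p ∘ suc) k

countPairs-< : ∀ {m} {r s : Fin m → Fin m → Bool} → (∀ a b → T (r a b) → T (s a b)) →
  ∀ {a b} → toℕ a < toℕ b → ¬ T (r a b) → T (s a b) → countPairs r < countPairs s
countPairs-< r⇒s {a} {b} a<b ¬rab sab =
  sumF-< (λ u → count-mono (λ w t → ∧-intro (∧-elimˡ t) (r⇒s u w (∧-elimʳ t)))) a
    (count-< (λ w t → ∧-intro (∧-elimˡ t) (r⇒s a w (∧-elimʳ t))) b
      (¬rab ∘ ∧-elimʳ) (∧-intro (<⇒<ᵇ a<b) sab))

gather : ∀ {A : Set} {m} → (Fin m → Bool) → (Fin m → List A) → List A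
gather {m = zero} p f = []
gather {m = suc m} p f = (if p zero then f zero else []) ++ gather (p ∘ suc) (f ∘ suc)

∈-gather : ∀ {A : Set} {m} (p : Fin m → Bool) (f : Fin m → List A) {a e} →
  T (p a) → e ∈ f a → e ∈ gather p f
∈-gather p f {zero} pa e∈fa with p zero | pa
... | true | _ = ∈-++⁺ˡ e∈fa
∈-gather p f {suc a} pa e∈fa = ∈-++⁺ʳ (if p zero then f zero else []) (∈-gather (p ∘ suc) (f ∘ suc) pa e∈fa)

gather-cong : ∀ {A : Set} {m} (p : Fin m → Bool) {f g : Fin m → List A} →
  (∀ a → T (p a) → f a ≡ g a) → gather p f ≡ gather p g
gather-cong {m = zero} p f≗g = refl
gather-cong {m = suc m} p f≗g with p zero | f≗g zero
... | true | eq = cong₂ _++_ (eq tt) (gather-cong (p ∘ suc) (f≗g ∘ suc))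
... | false | _ = gather-cong (p ∘ suc) (f≗g ∘ suc)

length-gather : ∀ {A : Set} {m} (p : Fin m → Bool) (f : Fin m → List A) →
  length (gather p f) ≡ sumF (λ a → if p a then length (f a) else 0)
length-gather {m = zero} p f = refl
length-gather {m = suc m} p f with p zero
... | true = trans (length-++ (f zero)) (cong (length (f zero) +_) (length-gather (p ∘ suc) (f ∘ suc)))
... | false = length-gather (p ∘ suc) (f ∘ suc)

length-gather-≤ : ∀ {A : Set} {m} (p q : Fin m → Bool) (f : Fin m → List A) k →
  (∀ a → T (p a) → length (f a) ≤ (if q a then k else 0)) → length (gather p f) ≤ k * count q
length-gather-≤ p q f k bound = begin
  length (gather p f)                           ≡⟨ length-gather p f ⟩
  sumF (λ a → if p a then length (f a) else 0)  ≤⟨ sumF-mono pointwise ⟩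
  sumF (λ a → if q a then k else 0)             ≡⟨ sumF-indicator q k ⟩
  k * count q                                   ∎
  where
  open ≤-Reasoning
  pointwise : ∀ a → (if p a then length (f a) else 0) ≤ (if q a then k else 0)
  pointwise a with p a | bound a
  ... | true | b = b tt
  ... | false | _ = z≤n

length-gather-uniform-≤ : ∀ {A : Set} {m} (p : Fin m → Bool) (f : Fin m → List A) k →
  (∀ a → T (p a) → length (f a) ≤ k) → length (gather p f) ≤ k * count p
length-gather-uniform-≤ p f k bound = length-gather-≤ p p f k (λ a pa → ≤-if pa (bound a pa))

length-gather-singletons : ∀ {A : Set} {m} (p : Fin m → Bool) (g : Fin m → A) →
  length (gather p (λ a → [ g a ])) ≤ count p
length-gather-singletons p g =
  subst (length (gather p (λ a → [ g a ])) ≤_) (*-identityˡ (count p))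
    (length-gather-uniform-≤ p (λ a → [ g a ]) 1 (λ _ _ → ≤-refl))

¬covers-short : ∀ {k} (L : List (Fin k)) → length L < k → ¬ (∀ c → c ∈ L)
¬covers-short L short covers with pigeonhole short (index ∘ covers)
... | i , j , i<j , same = Fin.<⇒≢ i<j (begin
  i                            ≡⟨ lookup-index (covers i) ⟩
  lookup L (index (covers i))  ≡⟨ cong (lookup L) same ⟩
  lookup L (index (covers j))  ≡⟨ lookup-index (covers j) ⟨
  j                            ∎)
  where open ≡-Reasoning

-- Opaque, so that goals mentioning a chosen colour are never normalised through the search.
opaque
  freshColour : ∀ {k} → List (Fin (suc k)) → Fin (suc k)
  freshColour L with any? (λ c → ¬? (Any.any? (c ≟_) L))
  ... | yes (c , _) = c
  ... | no _ = zero

  freshColour-∉ : ∀ {k} (L : List (Fin (suc k))) → length L ≤ k → freshColour L ∉ L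
  freshColour-∉ L short with any? (λ c → ¬? (Any.any? (c ≟_) L))
  ... | yes (_ , c∉L) = c∉L
  ... | no none = ⊥-elim (¬covers-short L (s≤s short)
          (λ c → decidable-stable (Any.any? (c ≟_) L) (λ c∉L → none (c , c∉L))))

-- Isolating a vertex

adj-sym : (G : Graph) {a b : Fin (n G)} → T (adj G a b) → T (adj G b a)
adj-sym G {a} {b} = subst T (symm G a b)

adj⇒≢ : (G : Graph) {a b : Fin (n G)} → T (adj G a b) → a ≢ b
adj⇒≢ G {a} ab refl = subst T (irrefl G a) ab

isolate : (G : Graph) → Fin (n G) → Graph
isolate G c = record
  { n      = n G
  ; adj    = λ a b → adj G a b ∧ (a ≢ᵇ c ∧ b ≢ᵇ c)
  ; symm   = λ a b → cong₂ _∧_ (symm G a b) (∧-comm (a ≢ᵇ c) (b ≢ᵇ c))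
  ; irrefl = λ a → cong (_∧ (a ≢ᵇ c ∧ a ≢ᵇ c)) (irrefl G a)
  }

module _ (G : Graph) (c : Fin (n G)) where

  isolate-adj : ∀ {a b} → T (adj G a b) → a ≢ c → b ≢ c → T (adj (isolate G c) a b)
  isolate-adj ab a≢c b≢c = ∧-intro ab (∧-intro (≢⇒≢ᵇ a≢c) (≢⇒≢ᵇ b≢c))

  isolate-⊆ : ∀ {a b} → T (adj (isolate G c) a b) → T (adj G a b)
  isolate-⊆ = ∧-elimˡ

  isolate-≢ˡ : ∀ {a b} → T (adj (isolate G c) a b) → a ≢ c
  isolate-≢ˡ {a} {b} ab = ≢ᵇ⇒≢ (∧-elimˡ {a ≢ᵇ c} (∧-elimʳ {adj G a b} ab))

  isolate-≢ʳ : ∀ {a b} → T (adj (isolate G c) a b) → b ≢ c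
  isolate-≢ʳ {a} {b} ab = ≢ᵇ⇒≢ (∧-elimʳ {a ≢ᵇ c} (∧-elimʳ {adj G a b} ab))

  isolate-deg-≤ : ∀ a → deg (isolate G c) a ≤ deg G a
  isolate-deg-≤ a = count-mono (λ b → isolate-⊆ {a} {b})

  isolate-deg-< : ∀ {a} → T (adj G a c) → deg (isolate G c) a < deg G a
  isolate-deg-< {a} ac = begin-strict
    deg (isolate G c) a
      ≤⟨ count-mono (λ b ab → ∧-intro (isolate-⊆ {a} {b} ab) (≢⇒≢ᵇ (isolate-≢ʳ ab))) ⟩
    count (λ b → adj G a b ∧ b ≢ᵇ c)
      <⟨ n<1+n _ ⟩
    suc (count (λ b → adj G a b ∧ b ≢ᵇ c))
      ≡⟨ count-remove (adj G a) ac ⟨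
    deg G a
      ∎
    where open ≤-Reasoning

  isolate-maxDeg : ∀ {k} → MaxDegAtMost k G → MaxDegAtMost k (isolate G c)
  isolate-maxDeg Δ≤k a = ≤-trans (isolate-deg-≤ a) (Δ≤k a)

  isolate-mad : ∀ {p q} → MadLessThan p q G → MadLessThan p q (isolate G c)
  isolate-mad mad F = mad record
    { vs = vs F ; es = es F ; es-sym = es-sym F
    ; es-adj = λ u v e → isolate-⊆ (es-adj F u v e) ; es-vs = es-vs F }

  isolate-edgeCount-< : ∀ {x} → T (adj G c x) → edgeCount (isolate G c) < edgeCount G
  isolate-edgeCount-< {x} cx with Fin.<-cmp c x
  ... | tri< c<x _ _ = countPairs-< (λ a b → isolate-⊆ {a} {b}) c<x (λ cx′ → isolate-≢ˡ cx′ refl) cx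
  ... | tri≈ _ c≡x _ = ⊥-elim (adj⇒≢ G cx c≡x)
  ... | tri> _ _ x<c = countPairs-< (λ a b → isolate-⊆ {a} {b}) x<c (λ xc′ → isolate-≢ʳ xc′ refl) (adj-sym G cx)

-- Extending a colouring of an isolated graph

neighbour≢centre : (G : Graph) {c a : Fin (n G)} → T (adj G c a) → a ≢ c
neighbour≢centre G ca a≡c = adj⇒≢ G ca (sym a≡c)

-- For an edge ab avoiding c, this covers, up to the orientation of ab, every way in which
-- ab is at distance two from cx or lies in a triangle with it.
Near : (G : Graph) (c x a b : Fin (n G)) → Set
Near G c x a b = (T (adj G c a) × a ≢ x) ⊎ (T (adj G x a) × b ≢ x)

module _ {k} (G : Graph) (c : Fin (n G)) (ψ : InjectiveEdgeColoring k (isolate G c))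
         (col : Fin (n G) → Fin k) where

  extended : Fin (n G) → Fin (n G) → Fin k
  extended a b with a ≟ c | b ≟ c
  ... | yes _ | _     = col b
  ... | no _  | yes _ = col a
  ... | no _  | no _  = φ ψ a b

  extended-centreˡ : ∀ b → extended c b ≡ col b
  extended-centreˡ b with c ≟ c | b ≟ c
  ... | yes _  | _ = refl
  ... | no c≢c | _ = ⊥-elim (c≢c refl)

  extended-centreʳ : ∀ {a} → a ≢ c → extended a c ≡ col a
  extended-centreʳ {a} a≢c with a ≟ c | c ≟ c
  ... | yes a≡c | _      = ⊥-elim (a≢c a≡c)
  ... | no _    | yes _  = refl
  ... | no _    | no c≢c = ⊥-elim (c≢c refl)

  extended-away : ∀ {a b} → a ≢ c → b ≢ c → extended a b ≡ φ ψ a b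
  extended-away {a} {b} a≢c b≢c with a ≟ c | b ≟ c
  ... | yes a≡c | _       = ⊥-elim (a≢c a≡c)
  ... | no _    | yes b≡c = ⊥-elim (b≢c b≡c)
  ... | no _    | no _    = refl

  extend-isolated :
    (∀ x a b → T (adj G c x) → T (adj (isolate G c) a b) → Near G c x a b → col x ≢ φ ψ a b) →
    (∀ x y → T (adj G c x) → T (adj G c y) → T (adj G x y) → col x ≢ col y) →
    InjectiveEdgeColoring k G
  extend-isolated avoids separates = record
    { φ = extended ; φ-sym = symmetric ; dist-two = distanceTwo ; triangle = triangles }
    where
    edge′ : ∀ {a b} → T (adj G a b) → a ≢ c → b ≢ c → T (adj (isolate G c) a b)
    edge′ = isolate-adj G c

    extended-flip : ∀ {a b} → T (adj (isolate G c) a b) → extended a b ≡ φ ψ b a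
    extended-flip ab = trans (extended-away (isolate-≢ˡ G c ab) (isolate-≢ʳ G c ab)) (φ-sym ψ _ _ ab)

    -- Matching on toSum (a ≟ c) rather than on a ≟ c keeps `extended` folded in the goals.
    symmetric : ∀ a b → T (adj G a b) → extended a b ≡ extended b a
    symmetric a b ab with toSum (a ≟ c) | toSum (b ≟ c)
    ... | inj₁ refl | _ = trans (extended-centreˡ b) (sym (extended-centreʳ (neighbour≢centre G ab)))
    ... | inj₂ a≢c | inj₁ refl = trans (extended-centreʳ a≢c) (sym (extended-centreˡ a))
    ... | inj₂ a≢c | inj₂ b≢c =
      trans (extended-flip (edge′ ab a≢c b≢c)) (sym (extended-away b≢c a≢c))

    distanceTwo : ∀ u v x y → T (adj G u v) → T (adj G x y) →
      u ≢ x → u ≢ y → v ≢ x → v ≢ y → T (adj G v x) → extended u v ≢ extended x y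
    distanceTwo u v x y uv xy u≢x u≢y v≢x v≢y vx with toSum (u ≟ c)
    ... | inj₁ refl = λ eq → avoids v x y uv xy′ (inj₂ (vx , v≢y ∘ sym))
            (trans (sym (extended-centreˡ v)) (trans eq (extended-away (u≢x ∘ sym) (u≢y ∘ sym))))
      where xy′ = edge′ xy (u≢x ∘ sym) (u≢y ∘ sym)
    ... | inj₂ u≢c with toSum (v ≟ c)
    ...   | inj₁ refl = λ eq → avoids u x y (adj-sym G uv) xy′ (inj₁ (vx , u≢x ∘ sym))
              (trans (sym (extended-centreʳ u≢c)) (trans eq (extended-away (v≢x ∘ sym) (v≢y ∘ sym))))
      where xy′ = edge′ xy (v≢x ∘ sym) (v≢y ∘ sym)
    ...   | inj₂ v≢c with toSum (x ≟ c)
    ...     | inj₁ refl = λ eq → avoids y v u xy (edge′ (adj-sym G uv) v≢c u≢c) (inj₁ (adj-sym G vx , v≢y))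
                (trans (sym (extended-centreˡ y)) (trans (sym eq) (extended-flip (edge′ uv u≢c v≢c))))
    ...     | inj₂ x≢c with toSum (y ≟ c)
    ...       | inj₁ refl = λ eq → avoids x v u (adj-sym G xy) (edge′ (adj-sym G uv) v≢c u≢c)
                  (inj₂ (adj-sym G vx , u≢x))
                  (trans (sym (extended-centreʳ x≢c)) (trans (sym eq) (extended-flip (edge′ uv u≢c v≢c))))
    ...       | inj₂ y≢c = λ eq → dist-two ψ u v x y (edge′ uv u≢c v≢c) (edge′ xy x≢c y≢c)
                  u≢x u≢y v≢x v≢y (edge′ vx v≢c x≢c)
                  (trans (sym (extended-away u≢c v≢c)) (trans eq (extended-away x≢c y≢c)))

    triangles : ∀ a b d → T (adj G a b) → T (adj G a d) → T (adj G b d) → extended a b ≢ extended a d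
    triangles a b d ab ad bd with toSum (a ≟ c)
    ... | inj₁ refl = λ eq → separates b d ab ad bd
            (trans (sym (extended-centreˡ b)) (trans eq (extended-centreˡ d)))
    ... | inj₂ a≢c with toSum (b ≟ c)
    ...   | inj₁ refl = λ eq → avoids a d a (adj-sym G ab) (edge′ (adj-sym G ad) d≢c a≢c)
              (inj₁ (bd , adj⇒≢ G (adj-sym G ad)))
              (trans (sym (extended-centreʳ a≢c)) (trans eq (extended-flip (edge′ ad a≢c d≢c))))
      where d≢c = neighbour≢centre G bd
    ...   | inj₂ b≢c with toSum (d ≟ c)
    ...     | inj₁ refl = λ eq → avoids a b a (adj-sym G ad) (edge′ (adj-sym G ab) b≢c a≢c)
                (inj₁ (adj-sym G bd , adj⇒≢ G (adj-sym G ab)))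
                (trans (sym (extended-centreʳ a≢c)) (trans (sym eq) (extended-flip (edge′ ab a≢c b≢c))))
    ...     | inj₂ d≢c = λ eq → triangle ψ a b d (edge′ ab a≢c b≢c) (edge′ ad a≢c d≢c) (edge′ bd b≢c d≢c)
                (trans (sym (extended-away a≢c b≢c)) (trans eq (extended-away a≢c d≢c)))

-- Recolouring the edges at an isolated vertex

EdgesInAtMostOneTriangle : (G : Graph) → Fin (n G) → Set
EdgesInAtMostOneTriangle G c = ∀ {x y z} → T (adj G c x) → T (adj G c y) → T (adj G c z) →
  T (adj G x y) → T (adj G x z) → y ≡ z

module _ (G : Graph) (c : Fin (n G)) (ψ : InjectiveEdgeColoring 7 (isolate G c)) where

  private
    V = Fin (n G)
    G′ = isolate G c

  others : V → List (Fin 7)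
  others x = gather (λ a → adj G c a ∧ a ≢ᵇ x) (λ a → gather (adj G′ a) (λ b → [ φ ψ a b ]))

  -- The edge from a neighbour a of x to c is itself being recoloured, so for such a only the
  -- colours `earlier x a` already chosen for it are forbidden; the ψ-colours at a lie in `others x`.
  beyond : (V → V → List (Fin 7)) → V → V → List (Fin 7)
  beyond earlier x a =
    if adj G c a then earlier x a else gather (λ b → adj G′ a b ∧ b ≢ᵇ x) (λ b → [ φ ψ a b ])

  forbidden : (V → V → List (Fin 7)) → V → List (Fin 7)
  forbidden earlier x = others x ++ gather (adj G′ x) (beyond earlier x)

  firstPass : V → Fin 7
  firstPass = freshColour ∘ forbidden (λ _ _ → [])

  earlierFirstPass : V → V → List (Fin 7)
  earlierFirstPass x a = if toℕ a <ᵇ toℕ x then [ firstPass a ] else []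

  secondPass : V → Fin 7
  secondPass = freshColour ∘ forbidden earlierFirstPass

  beyond-centre : ∀ earlier x {a} → T (adj G c a) → beyond earlier x a ≡ earlier x a
  beyond-centre earlier x {a} ca with adj G c a
  ... | true = refl

  beyond-away : ∀ earlier x {a} → ¬ T (adj G c a) →
    beyond earlier x a ≡ gather (λ b → adj G′ a b ∧ b ≢ᵇ x) (λ b → [ φ ψ a b ])
  beyond-away earlier x {a} ¬ca with adj G c a
  ... | true = ⊥-elim (¬ca tt)
  ... | false = refl

  forbidden-∋ : ∀ earlier x {a b} → T (adj G c x) → T (adj G′ a b) → Near G c x a b →
    φ ψ a b ∈ forbidden earlier x
  forbidden-∋ earlier x {a} cx ab (inj₁ (ca , a≢x)) =
    ∈-++⁺ˡ (∈-gather (λ a′ → adj G c a′ ∧ a′ ≢ᵇ x) _ (∧-intro ca (≢⇒≢ᵇ a≢x))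
      (∈-gather (adj G′ a) _ ab (here refl)))
  forbidden-∋ earlier x {a} cx ab (inj₂ (xa , b≢x)) with T? (adj G c a)
  ... | yes ca = forbidden-∋ earlier x cx ab (inj₁ (ca , adj⇒≢ G xa ∘ sym))
  ... | no ¬ca = ∈-++⁺ʳ (others x) (∈-gather (adj G′ x) (beyond earlier x)
          (isolate-adj G c xa (neighbour≢centre G cx) (isolate-≢ˡ G c ab))
          (subst (_ ∈_) (sym (beyond-away earlier x ¬ca))
            (∈-gather (λ b′ → adj G′ a b′ ∧ b′ ≢ᵇ x) _ (∧-intro ab (≢⇒≢ᵇ b≢x)) (here refl))))

  earlierFirstPass-below : ∀ {x a} → toℕ a < toℕ x → earlierFirstPass x a ≡ [ firstPass a ]
  earlierFirstPass-below a<x = if-true (<⇒<ᵇ a<x)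

  earlierFirstPass-above : ∀ {x a} → toℕ x < toℕ a → earlierFirstPass x a ≡ []
  earlierFirstPass-above {x} {a} x<a = if-false (λ a<ᵇx → <-asym x<a (<ᵇ⇒< (toℕ a) (toℕ x) a<ᵇx))

  ShortForbidden : Set
  ShortForbidden = ∀ x → T (adj G c x) → length (forbidden earlierFirstPass x) ≤ 6

  module _ (unique : EdgesInAtMostOneTriangle G c) (short : ShortForbidden) where

    secondPass-avoids : ∀ x a b → T (adj G c x) → T (adj G′ a b) → Near G c x a b → secondPass x ≢ φ ψ a b
    secondPass-avoids x a b cx ab near eq = freshColour-∉ _ (short x cx)
      (subst (_∈ forbidden earlierFirstPass x) (sym eq) (forbidden-∋ earlierFirstPass x cx ab near))

    -- In its only triangle cxy the edge cx comes first, so it sees no earlier colour and both passes agree on it.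
    secondPass-lower : ∀ {x y} → T (adj G c x) → T (adj G c y) → T (adj G x y) → toℕ x < toℕ y →
      secondPass x ≡ firstPass x
    secondPass-lower {x} {y} cx cy xy x<y =
      cong (λ L → freshColour (others x ++ L)) (gather-cong (adj G′ x) sameBeyond)
      where
      sameBeyond : ∀ a → T (adj G′ x a) → beyond earlierFirstPass x a ≡ beyond (λ _ _ → []) x a
      sameBeyond a xa with T? (adj G c a)
      ... | no ¬ca = trans (beyond-away earlierFirstPass x ¬ca) (sym (beyond-away (λ _ _ → []) x ¬ca))
      ... | yes ca with unique cx ca cy (isolate-⊆ G c xa) xy
      ...   | refl = trans (beyond-centre earlierFirstPass x ca)
                       (trans (earlierFirstPass-above x<y) (sym (beyond-centre (λ _ _ → []) x ca)))

    firstPass-forbidden : ∀ {x y} → T (adj G c x) → T (adj G c y) → T (adj G x y) → toℕ x < toℕ y →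
      firstPass x ∈ forbidden earlierFirstPass y
    firstPass-forbidden {x} {y} cx cy xy x<y = ∈-++⁺ʳ (others y)
      (∈-gather (adj G′ y) (beyond earlierFirstPass y)
        (isolate-adj G c (adj-sym G xy) (neighbour≢centre G cy) (neighbour≢centre G cx))
        (subst (_ ∈_) (sym (trans (beyond-centre earlierFirstPass y cx) (earlierFirstPass-below x<y)))
          (here refl)))

    secondPass-separates-< : ∀ {x y} → T (adj G c x) → T (adj G c y) → T (adj G x y) → toℕ x < toℕ y →
      secondPass x ≢ secondPass y
    secondPass-separates-< {x} {y} cx cy xy x<y eq = freshColour-∉ _ (short y cy)
      (subst (_∈ forbidden earlierFirstPass y) (trans (sym (secondPass-lower cx cy xy x<y)) eq)
        (firstPass-forbidden cx cy xy x<y))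

    secondPass-separates : ∀ x y → T (adj G c x) → T (adj G c y) → T (adj G x y) → secondPass x ≢ secondPass y
    secondPass-separates x y cx cy xy with Fin.<-cmp x y
    ... | tri< x<y _ _ = secondPass-separates-< cx cy xy x<y
    ... | tri≈ _ x≡y _ = ⊥-elim (adj⇒≢ G xy x≡y)
    ... | tri> _ _ y<x = secondPass-separates-< cy cx (adj-sym G xy) y<x ∘ sym

    recolour : InjectiveEdgeColoring 7 G
    recolour = extend-isolated G c ψ secondPass secondPass-avoids secondPass-separates

  length-others-≤ : ∀ k x → (∀ a → T (adj G c a) → deg G′ a ≤ k) →
    length (others x) ≤ k * count (λ a → adj G c a ∧ a ≢ᵇ x)
  length-others-≤ k x bound = length-gather-uniform-≤ _ _ k
    (λ a p → ≤-trans (length-gather-singletons (adj G′ a) (φ ψ a)) (bound a (∧-elimˡ p)))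

  length-beyond-away : ∀ earlier x {a} → ¬ T (adj G c a) → T (adj G′ x a) →
    suc (length (beyond earlier x a)) ≤ deg G a
  length-beyond-away earlier x {a} ¬ca xa = begin
    suc (length (beyond earlier x a))   ≤⟨ s≤s (≤-reflexive (cong length (beyond-away earlier x ¬ca))) ⟩
    suc (length (gather (λ b → adj G′ a b ∧ b ≢ᵇ x) (λ b → [ φ ψ a b ])))
                                        ≤⟨ s≤s (length-gather-singletons (λ b → adj G′ a b ∧ b ≢ᵇ x) (φ ψ a)) ⟩
    suc (count (λ b → adj G′ a b ∧ b ≢ᵇ x)) ≡⟨ count-remove (adj G′ a) (adj-sym G′ xa) ⟨
    deg G′ a                            ≤⟨ isolate-deg-≤ G c a ⟩
    deg G a                             ∎
    where open ≤-Reasoning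

  length-beyond-≤ : MaxDegAtMost 4 G → ∀ earlier x {a} → (T (adj G c a) → length (earlier x a) ≤ 3) →
    T (adj G′ x a) → length (beyond earlier x a) ≤ 3
  length-beyond-≤ Δ≤4 earlier x {a} earlierShort xa with T? (adj G c a)
  ... | yes ca = subst (λ L → length L ≤ 3) (sym (beyond-centre earlier x ca)) (earlierShort ca)
  ... | no ¬ca = ≤-pred (≤-trans (length-beyond-away earlier x ¬ca xa) (Δ≤4 a))

  length-earlierFirstPass-≤ : ∀ x a → length (earlierFirstPass x a) ≤ 3
  length-earlierFirstPass-≤ x a with toℕ a <ᵇ toℕ x
  ... | true = s≤s z≤n
  ... | false = z≤n

-- Reducible configurations

module _ (G : Graph) (Δ≤4 : MaxDegAtMost 4 G) {c : Fin (n G)}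
         (ψ : InjectiveEdgeColoring 7 (isolate G c)) where

  private
    G′ = isolate G c

  extend-lowNeighbourhood : (∀ x → T (adj G c x) → deg G x ≤ 2) → InjectiveEdgeColoring 7 G
  extend-lowNeighbourhood low = recolour G c ψ unique short
    where
    deg′≤1 : ∀ a → T (adj G c a) → deg G′ a ≤ 1
    deg′≤1 a ca = ≤-pred (≤-trans (isolate-deg-< G c (adj-sym G ca)) (low a ca))

    unique : EdgesInAtMostOneTriangle G c
    unique {x} {y} {z} cx cy cz xy xz =
      count≤1-unique (λ b → adj G x b ∧ b ≢ᵇ c) (count-remove-≤ (adj G x) (low x cx) (adj-sym G cx))
        (∧-intro xz (≢⇒≢ᵇ (neighbour≢centre G cz))) (∧-intro xy (≢⇒≢ᵇ (neighbour≢centre G cy)))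

    short : ShortForbidden G c ψ
    short x cx = begin
      length (forbidden G c ψ (earlierFirstPass G c ψ) x)
        ≡⟨ length-++ (others G c ψ x) ⟩
      length (others G c ψ x) + length (gather (adj G′ x) (beyond G c ψ (earlierFirstPass G c ψ) x))
        ≤⟨ +-mono-≤ (≤-trans (length-others-≤ G c ψ 1 x deg′≤1)
                             (*-monoʳ-≤ 1 (count-remove-≤ (adj G c) (Δ≤4 c) cx)))
                    (≤-trans (length-gather-uniform-≤ _ _ 3
                                (λ a → length-beyond-≤ G c ψ Δ≤4 (earlierFirstPass G c ψ) x (λ _ → length-earlierFirstPass-≤ G c ψ x a)))
                             (*-monoʳ-≤ 3 (deg′≤1 x cx))) ⟩
      1 * 3 + 3 * 1 ∎
      where open ≤-Reasoning

  extend-leaf : ∀ {x} → deg G c ≡ 1 → T (adj G c x) →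
    deg G x ≤ 3 ⊎ (∃[ l ] (T (adj G x l) × l ≢ c × deg G l ≡ 1)) → InjectiveEdgeColoring 7 G
  extend-leaf {x} leaf cx room = recolour G c ψ unique short
    where
    onlyNeighbour : ∀ {y} → T (adj G c y) → y ≡ x
    onlyNeighbour cy = count≤1-unique (adj G c) (≤-reflexive leaf) cx cy

    unique : EdgesInAtMostOneTriangle G c
    unique _ cy cz _ _ = trans (onlyNeighbour cy) (sym (onlyNeighbour cz))

    noOthers : length (others G c ψ x) ≤ 0
    noOthers = ≤-trans (length-others-≤ G c ψ 4 x (λ a _ → ≤-trans (isolate-deg-≤ G c a) (Δ≤4 a)))
                       (*-monoʳ-≤ 4 (count-remove-≤ (adj G c) (≤-reflexive leaf) cx))

    beyondsShort : ∀ a → T (adj G′ x a) → length (beyond G c ψ (earlierFirstPass G c ψ) x a) ≤ 3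
    beyondsShort a = length-beyond-≤ G c ψ Δ≤4 (earlierFirstPass G c ψ) x (λ _ → length-earlierFirstPass-≤ G c ψ x a)

    beyonds : deg G x ≤ 3 ⊎ (∃[ l ] (T (adj G x l) × l ≢ c × deg G l ≡ 1)) →
      length (gather (adj G′ x) (beyond G c ψ (earlierFirstPass G c ψ) x)) ≤ 3 * 2
    beyonds (inj₁ dx≤3) = ≤-trans (length-gather-uniform-≤ _ _ 3 beyondsShort)
      (*-monoʳ-≤ 3 (≤-pred (≤-trans (isolate-deg-< G c (adj-sym G cx)) dx≤3)))
    beyonds (inj₂ (l , xl , l≢c , leafˡ)) =
      ≤-trans (length-gather-≤ (adj G′ x) (λ a → adj G′ x a ∧ a ≢ᵇ l) _ 3 pointwise)
        (*-monoʳ-≤ 3 (count-remove-≤ (adj G′ x)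
          (≤-pred (≤-trans (isolate-deg-< G c (adj-sym G cx)) (Δ≤4 x)))
          (isolate-adj G c xl (neighbour≢centre G cx) l≢c)))
      where
      ¬cl : ¬ T (adj G c l)
      ¬cl cl = adj⇒≢ G xl (sym (onlyNeighbour cl))
      pointwise : ∀ a → T (adj G′ x a) →
        length (beyond G c ψ (earlierFirstPass G c ψ) x a) ≤ (if adj G′ x a ∧ a ≢ᵇ l then 3 else 0)
      pointwise a xa with toSum (a ≟ l)
      ... | inj₁ refl = ≤-trans (≤-pred (≤-trans
                          (length-beyond-away G c ψ (earlierFirstPass G c ψ) x ¬cl xa) (≤-reflexive leafˡ))) z≤n
      ... | inj₂ a≢l = ≤-if (∧-intro xa (≢⇒≢ᵇ a≢l)) (beyondsShort a xa)

    short : ShortForbidden G c ψ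
    short y cy with onlyNeighbour cy
    ... | refl = begin
      length (forbidden G c ψ (earlierFirstPass G c ψ) x)
        ≡⟨ length-++ (others G c ψ x) ⟩
      length (others G c ψ x) + length (gather (adj G′ x) (beyond G c ψ (earlierFirstPass G c ψ) x))
        ≤⟨ +-mono-≤ noOthers (beyonds room) ⟩
      0 + 3 * 2 ∎
      where open ≤-Reasoning

-- Minimal counterexamples

edgeless-colouring : ∀ {k} (G : Graph) → (∀ a b → ¬ T (adj G a b)) → InjectiveEdgeColoring (suc k) G
edgeless-colouring G noEdge = record
  { φ        = λ _ _ → zero
  ; φ-sym    = λ a b ab → ⊥-elim (noEdge a b ab)
  ; dist-two = λ u v _ _ uv _ _ _ _ _ _ → ⊥-elim (noEdge u v uv)
  ; triangle = λ a b _ ab _ _ → ⊥-elim (noEdge a b ab)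
  }

isolated⇒edgeless : (G : Graph) → Connected G → ∀ {v} → (∀ x → ¬ T (adj G v x)) → ∀ a b → ¬ T (adj G a b)
isolated⇒edgeless G connected {v} isolated a b = noEdgeFrom (connected a v)
  where
  noEdgeFrom : ∀ {a b} → Reach G a v → ¬ T (adj G a b)
  noEdgeFrom here = isolated _
  noEdgeFrom (step aw w⇝v) _ = noEdgeFrom w⇝v (adj-sym G aw)

inH-intro : (G : Graph) {u : Fin (n G)} → deg G u ≢ 1 → T (inH G u)
inH-intro G {u} du≢1 with deg G u ≡ᵇ 1 | ≡ᵇ⇒≡ (deg G u) 1
... | false | _ = tt
... | true | du≡1 = du≢1 (du≡1 tt)

module _ {G : Graph} (mc : MinimalCounterexample G) where

  private
    connected    = proj₁ mc
    Δ≤4          = proj₁ (proj₂ mc)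
    mad<8/3      = proj₁ (proj₂ (proj₂ mc))
    uncolourable = proj₁ (proj₂ (proj₂ (proj₂ mc)))
    minimal      = proj₂ (proj₂ (proj₂ (proj₂ mc)))

  isolate-colourable : ∀ {c x} → T (adj G c x) → InjectiveEdgeColoring 7 (isolate G c)
  isolate-colourable {c} cx = minimal (isolate G c) (isolate-maxDeg G c Δ≤4) (isolate-mad G c {8} {3} mad<8/3)
    (+-monoʳ-< (n G) (isolate-edgeCount-< G c cx))

  neighbour-deg≥3 : ∀ v → ∃[ u ] (T (adj G v u) × 3 ≤ deg G u)
  neighbour-deg≥3 v with any? (λ u → T? (adj G v u) ×-dec (3 ≤? deg G u))
  ... | yes found = found
  ... | no none with any? (λ x → T? (adj G v x))
  ...   | yes (x , vx) = ⊥-elim (uncolourable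
            (extend-lowNeighbourhood G Δ≤4 (isolate-colourable vx) (λ u vu → ≮⇒≥ (λ 2<du → none (u , vu , 2<du)))))
  ...   | no isolated = ⊥-elim (uncolourable
            (edgeless-colouring G (isolated⇒edgeless G connected (λ x vx → isolated (x , vx)))))

  leafNeighbour-deg≥4 : ∀ {l u} → deg G l ≡ 1 → T (adj G l u) → 4 ≤ deg G u
  leafNeighbour-deg≥4 leaf lu = ≰⇒> (λ du≤3 →
    uncolourable (extend-leaf G Δ≤4 (isolate-colourable lu) leaf lu (inj₁ du≤3)))

  leafNeighbour-uniqueLeaf : ∀ {l u w} → deg G l ≡ 1 → T (adj G l u) → T (adj G u w) → w ≢ l → deg G w ≢ 1
  leafNeighbour-uniqueLeaf leaf lu uw w≢l leafʷ =
    uncolourable (extend-leaf G Δ≤4 (isolate-colourable lu) leaf lu (inj₂ (_ , uw , w≢l , leafʷ)))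

  degH≥3 : ∀ {u} → 3 ≤ deg G u → 3 ≤ degH G u
  degH≥3 {u} 3≤du with any? (λ l → T? (adj G u l) ×-dec (deg G l Nat.≟ 1))
  ... | no noLeaf = ≤-trans 3≤du (count-mono (λ w uw → ∧-intro uw (inH-intro G (λ leafʷ → noLeaf (w , uw , leafʷ)))))
  ... | yes (l , ul , leaf) = begin
    3                                   ≤⟨ ≤-pred (subst (4 ≤_) (count-remove (adj G u) ul)
                                             (leafNeighbour-deg≥4 leaf (adj-sym G ul))) ⟩
    count (λ w → adj G u w ∧ w ≢ᵇ l)   ≤⟨ count-mono (λ w p → ∧-intro (∧-elimˡ p)
                                             (inH-intro G (leafNeighbour-uniqueLeaf leaf (adj-sym G ul)
                                               (∧-elimˡ p) (≢ᵇ⇒≢ (∧-elimʳ {adj G u w} p))))) ⟩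
    degH G u                            ∎
    where open ≤-Reasoning

lemma2p6 : (G : Graph) → MinimalCounterexample G →
    ((v : _) → ∃[ u ] (T (adj G v u) × 3 ≤ deg G u)) ×
    ((v : _) → T (inH G v) →
       ∃[ u ] (T (adj G v u) × T (inH G u) × 3 ≤ degH G u))
lemma2p6 G mc = neighbour-deg≥3 mc , λ v _ → inH-neighbour (neighbour-deg≥3 mc v)
  where
  inH-neighbour : ∀ {v} → ∃[ u ] (T (adj G v u) × 3 ≤ deg G u) →
    ∃[ u ] (T (adj G v u) × T (inH G u) × 3 ≤ degH G u)
  inH-neighbour (u , vu , 3≤du) = u , vu , inH-intro G (<⇒≢ (≤-trans (s≤s (s≤s z≤n)) 3≤du) ∘ sym) , degH≥3 mc 3≤du
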